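{- Let $U\subseteq\binom{[n]}{m}$ be nonempty and let $l\in[n]$ with $l>m$. Let $V=Ext(U,l)$ and let $\mathcal{D}$ be the family of double marks of $U$ and $V$. Then $$\kappa(U)\le\kappa(\mathcal{D})\le 2\kappa(U)-\kappa(Ext(U,l)).$$
   Context: $[n]=\{1,\dots,n\}$, $\binom{[n]}{m}$ is the family of $m$-subsets. $\kappa(U)=\ln\binom{n}{m}-\ln|U|$ and $\kappa(V)=\ln\binom{n}{l}-\ln|V|$ for nonempty $V\subseteq\binom{[n]}{l}$. $Ext(U,l)=\{t\in\binom{[n]}{l}:\exists s\in U,\ s\subseteq t\}$. A double mark is a triple $(t,t',d)$ with $t,t'\in U$, $d\in V$ and $t\cup t'\subseteq d$. The sparsity of the family $\mathcal{D}$ of all double marks is $\kappa(\mathcal{D})=-\ln\frac{|\mathcal{D}|}{\binom{n}{l}\binom{l}{m}^2}$. -}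

module Defs where

open import Data.Nat using (ℕ; zero; suc; _≟_)
open import Data.Product using (_×_; _,_)
open import Data.List using (List; []; _∷_; _++_; map; filter; cartesianProduct)
open import Data.List.Relation.Unary.Any using (Any; any?)
open import Data.Fin.Subset using (Subset; inside; outside; _⊆_; _∪_; ∣_∣)
open import Data.Fin.Subset.Properties using (_⊆?_)
open import Data.Vec using (_∷_; [])
open import Relation.Nullary.Decidable using (_×-dec_)

allSubsets : (n : ℕ) → List (Subset n)
allSubsets zero = [] ∷ []
allSubsets (suc n) = map (inside ∷_) (allSubsets n) ++ map (outside ∷_) (allSubsets n)

Ext : {n : ℕ} → List (Subset n) → ℕ → List (Subset n)
Ext {n} U l = filter (λ t → (∣ t ∣ ≟ l) ×-dec any? (λ s → s ⊆? t) U) (allSubsets n)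

DoubleMarks : {n : ℕ} → List (Subset n) → List (Subset n) →
              List (Subset n × Subset n × Subset n)
DoubleMarks U V =
  filter (λ { (t , t' , d) → (t ∪ t') ⊆? d }) (cartesianProduct U (cartesianProduct U V))

{-# OPTIONS --safe #-}
module Submission where

-- Let a(d) be the number of t ∈ U with t ⊆ d. Counting triples gives |𝒟| = Σ_{d∈V} a(d)², and
-- since every l-superset of a member of U lies in V = Ext(U,l), counting pairs t ⊆ d gives
-- Σ_{d∈V} a(d) = |U|·C(n−m,l−m). As U has no repetitions, a(d) ≤ C(l,m), so
-- Σ a(d)² ≤ C(l,m)·Σ a(d), which is κ(U) ≤ κ(𝒟); Cauchy–Schwarz, (Σ a(d))² ≤ |V|·Σ a(d)², is
-- κ(𝒟) ≤ 2κ(U) − κ(V). Both are rewritten with C(n,m)·C(n−m,l−m) = C(n,l)·C(l,m).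

open import Defs
open import Level using (Level)
open import Function using (_∘_)
import Algebra.Properties.CommutativeSemigroup as CommSemigroupProperties
open import Data.Bool.Base using (true; false; if_then_else_)
open import Data.Empty using (⊥; ⊥-elim)
open import Data.Fin.Subset using (Subset; inside; outside; ⊤; _⊆_; _∪_; ∣_∣)
open import Data.Fin.Subset.Properties
  using (_⊆?_; ∣p∣≤n; ∣⊤∣≡n; ⊆⊤; ⊆-trans; p⊆p∪q; q⊆p∪q; x∈p∪q⁻; p⊆q⇒∣p∣≤∣q∣)
open import Data.List using (List; []; _∷_; _++_; length; map; filter; cartesianProduct)
open import Data.List.Membership.Propositional using (_∈_; lose)
open import Data.List.Membership.Propositional.Properties
  using (∈-∃++; ∈-++⁺ˡ; ∈-++⁺ʳ; ∈-++⁻; ∈-map⁺; ∈-filter⁻)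
open import Data.List.Relation.Unary.All as All using (All)
open import Data.List.Relation.Unary.AllPairs using (_∷_)
open import Data.List.Relation.Unary.Any using (Any; here; there; any?)
open import Data.List.Relation.Unary.Unique.Propositional using (Unique)
open import Data.Nat using (ℕ; zero; suc; _+_; _∸_; _*_; _^_; _≤_; _<_; z≤n; _≟_)
open import Data.Nat.Combinatorics using (_C_; nCk+nC[k+1]≡[n+1]C[k+1])
open import Data.Nat.Properties
  using (+-assoc; +-comm; +-suc; +-identityʳ; +-∸-assoc; m+[n∸m]≡n; *-assoc; *-comm; *-identityˡ;
         *-identityʳ; *-zeroʳ; *-distribˡ-+; *-distribʳ-+; +-commutativeSemigroup; *-commutativeSemigroup;
         ≤-trans; ≤-total; ≤-reflexive; 1+n≰n; <⇒≤; m≤m+n; m≤n⇒∃[o]m+o≡n; +-monoʳ-≤; +-mono-≤;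
         *-monoˡ-≤; *-cancelˡ-≤; module ≤-Reasoning)
open import Data.Nat.Solver using (module +-*-Solver)
open +-*-Solver using (solve; _:+_; _:*_; _:^_; _:=_; con)
open import Data.Product using (_×_; _,_; proj₁; proj₂)
open import Data.Sum using (inj₁; inj₂; [_,_]′)
open import Data.Vec using ([]; _∷_)
open import Relation.Nullary using (Dec; yes; no; does; _×-dec_)
open import Relation.Binary.PropositionalEquality
  using (_≡_; _≢_; refl; sym; trans; cong; cong₂; subst; subst₂; module ≡-Reasoning)

private
  variable
    a b p q : Level
    A : Set a
    B : Set b
    P : Set p
    Q : Set q
    n : ℕ

  module +-CS = CommSemigroupProperties +-commutativeSemigroup
  module *-CS = CommSemigroupProperties *-commutativeSemigroup

𝟙 : Dec P → ℕ
𝟙 P? = if does P? then 1 else 0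

𝟙-yes : P → (P? : Dec P) → 𝟙 P? ≡ 1
𝟙-yes _ (yes _) = refl
𝟙-yes p (no ¬p) = ⊥-elim (¬p p)

𝟙-⇔ : (P → Q) → (Q → P) → (P? : Dec P) (Q? : Dec Q) → 𝟙 P? ≡ 𝟙 Q?
𝟙-⇔ to _    (yes p) Q?      = sym (𝟙-yes (to p) Q?)
𝟙-⇔ _  from (no ¬p) (yes q) = ⊥-elim (¬p (from q))
𝟙-⇔ _  _    (no _)  (no _)  = refl

𝟙-× : (P? : Dec P) (Q? : Dec Q) → 𝟙 (P? ×-dec Q?) ≡ 𝟙 P? * 𝟙 Q?
𝟙-× (yes _) (yes _) = refl
𝟙-× (yes _) (no _)  = refl
𝟙-× (no _)  _       = refl

𝟙*𝟙-disjoint : (P → Q → ⊥) → (P? : Dec P) (Q? : Dec Q) → 𝟙 P? * 𝟙 Q? ≡ 0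
𝟙*𝟙-disjoint _    (no _)  _       = refl
𝟙*𝟙-disjoint _    (yes _) (no _)  = refl
𝟙*𝟙-disjoint disj (yes p) (yes q) = ⊥-elim (disj p q)

𝟙*𝟙-implied : (P → Q) → (P? : Dec P) (Q? : Dec Q) → 𝟙 Q? * 𝟙 P? ≡ 𝟙 P?
𝟙*𝟙-implied P⇒Q P? Q? =
  trans (sym (𝟙-× Q? P?)) (𝟙-⇔ proj₂ (λ p → P⇒Q p , p) (Q? ×-dec P?) P?)

𝟙*-cong : (P? : Dec P) {x y : ℕ} → (P → x ≡ y) → 𝟙 P? * x ≡ 𝟙 P? * y
𝟙*-cong (yes p) x≡y = cong (_+ 0) (x≡y p)
𝟙*-cong (no _)  _   = refl

∑ : List A → (A → ℕ) → ℕ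
∑ []       f = 0
∑ (x ∷ xs) f = f x + ∑ xs f

infix 5 ∑
syntax ∑ xs (λ x → e) = ∑[ x ∈ xs ] e

∑-cong : {xs : List A} {f g : A → ℕ} → (∀ {x} → x ∈ xs → f x ≡ g x) → ∑ xs f ≡ ∑ xs g
∑-cong {xs = []}     _  = refl
∑-cong {xs = x ∷ xs} eq = cong₂ _+_ (eq (here refl)) (∑-cong {xs = xs} (eq ∘ there))

∑-mono-≤ : {xs : List A} {f g : A → ℕ} → (∀ {x} → x ∈ xs → f x ≤ g x) → ∑ xs f ≤ ∑ xs g
∑-mono-≤ {xs = []}     _  = z≤n
∑-mono-≤ {xs = x ∷ xs} le = +-mono-≤ (le (here refl)) (∑-mono-≤ {xs = xs} (le ∘ there))

∑-≡0 : {xs : List A} {f : A → ℕ} → (∀ x → f x ≡ 0) → ∑ xs f ≡ 0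
∑-≡0 {xs = []}     _  = refl
∑-≡0 {xs = x ∷ xs} eq = cong₂ _+_ (eq x) (∑-≡0 {xs = xs} eq)

∑-const : (xs : List A) (c : ℕ) → ∑[ x ∈ xs ] c ≡ length xs * c
∑-const []       c = refl
∑-const (x ∷ xs) c = cong (c +_) (∑-const xs c)

∑-++ : (xs ys : List A) (f : A → ℕ) → ∑ (xs ++ ys) f ≡ ∑ xs f + ∑ ys f
∑-++ []       ys f = refl
∑-++ (x ∷ xs) ys f = trans (cong (f x +_) (∑-++ xs ys f)) (sym (+-assoc (f x) _ _))

∑-map : (g : B → A) (xs : List B) (f : A → ℕ) → ∑ (map g xs) f ≡ ∑[ x ∈ xs ] f (g x)
∑-map g []       f = refl
∑-map g (x ∷ xs) f = cong (f (g x) +_) (∑-map g xs f)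

∑-distrib-+ : (xs : List A) (f g : A → ℕ) → ∑[ x ∈ xs ] (f x + g x) ≡ ∑ xs f + ∑ xs g
∑-distrib-+ []       f g = refl
∑-distrib-+ (x ∷ xs) f g =
  trans (cong (f x + g x +_) (∑-distrib-+ xs f g)) (+-CS.interchange (f x) (g x) _ _)

*-distribˡ-∑ : (xs : List A) (c : ℕ) (f : A → ℕ) → ∑[ x ∈ xs ] c * f x ≡ c * ∑ xs f
*-distribˡ-∑ []       c f = sym (*-zeroʳ c)
*-distribˡ-∑ (x ∷ xs) c f =
  trans (cong (c * f x +_) (*-distribˡ-∑ xs c f)) (sym (*-distribˡ-+ c (f x) _))

*-distribʳ-∑ : (xs : List A) (c : ℕ) (f : A → ℕ) → ∑[ x ∈ xs ] f x * c ≡ ∑ xs f * c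
*-distribʳ-∑ []       c f = refl
*-distribʳ-∑ (x ∷ xs) c f =
  trans (cong (f x * c +_) (*-distribʳ-∑ xs c f)) (sym (*-distribʳ-+ c (f x) _))

∑-comm : (xs : List A) (ys : List B) (f : A → B → ℕ) →
         ∑[ x ∈ xs ] ∑[ y ∈ ys ] f x y ≡ ∑[ y ∈ ys ] ∑[ x ∈ xs ] f x y
∑-comm []       ys f = sym (∑-≡0 {xs = ys} (λ _ → refl))
∑-comm (x ∷ xs) ys f =
  trans (cong (∑ ys (f x) +_) (∑-comm xs ys f)) (sym (∑-distrib-+ ys (f x) _))

∑*∑ : (xs : List A) (ys : List B) (f : A → ℕ) (g : B → ℕ) →
      ∑ xs f * ∑ ys g ≡ ∑[ x ∈ xs ] ∑[ y ∈ ys ] f x * g y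
∑*∑ xs ys f g = begin
  ∑ xs f * ∑ ys g                    ≡⟨ *-distribʳ-∑ xs (∑ ys g) f ⟨
  ∑[ x ∈ xs ] f x * ∑ ys g           ≡⟨ ∑-cong {xs = xs} (λ {x} _ → *-distribˡ-∑ ys (f x) g) ⟨
  ∑[ x ∈ xs ] ∑[ y ∈ ys ] f x * g y  ∎
  where open ≡-Reasoning

∑-cartesianProduct : (xs : List A) (ys : List B) (f : A × B → ℕ) →
                     ∑ (cartesianProduct xs ys) f ≡ ∑[ x ∈ xs ] ∑[ y ∈ ys ] f (x , y)
∑-cartesianProduct []       ys f = refl
∑-cartesianProduct (x ∷ xs) ys f =
  trans (∑-++ (map (x ,_) ys) _ f) (cong₂ _+_ (∑-map (x ,_) ys f) (∑-cartesianProduct xs ys f))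

∑-filter : {P : A → Set p} (P? : ∀ x → Dec (P x)) (xs : List A) (f : A → ℕ) →
           ∑ (filter P? xs) f ≡ ∑[ x ∈ xs ] 𝟙 (P? x) * f x
∑-filter P? []       f = refl
∑-filter P? (x ∷ xs) f with does (P? x)
... | true  = cong₂ _+_ (sym (+-identityʳ (f x))) (∑-filter P? xs f)
... | false = ∑-filter P? xs f

length-filter : {P : A → Set p} (P? : ∀ x → Dec (P x)) (xs : List A) →
                length (filter P? xs) ≡ ∑[ x ∈ xs ] 𝟙 (P? x)
length-filter P? []       = refl
length-filter P? (x ∷ xs) with does (P? x)
... | true  = cong suc (length-filter P? xs)
... | false = length-filter P? xs

∑-mono-⊆ : {xs ys : List A} (f : A → ℕ) → Unique xs → (∀ {x} → x ∈ xs → x ∈ ys) → ∑ xs f ≤ ∑ ys f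
∑-mono-⊆ {xs = []}     f _                  _     = z≤n
∑-mono-⊆ {xs = x ∷ xs} f (x∉xs ∷ xs-unique) xs⊆ys with ∈-∃++ (xs⊆ys (here refl))
... | ys₁ , ys₂ , refl = begin
  f x + ∑ xs f               ≤⟨ +-monoʳ-≤ (f x) (∑-mono-⊆ f xs-unique xs⊆ys₁++ys₂) ⟩
  f x + ∑ (ys₁ ++ ys₂) f     ≡⟨ cong (f x +_) (∑-++ ys₁ ys₂ f) ⟩
  f x + (∑ ys₁ f + ∑ ys₂ f)  ≡⟨ +-CS.x∙yz≈y∙xz (f x) (∑ ys₁ f) (∑ ys₂ f) ⟩
  ∑ ys₁ f + (f x + ∑ ys₂ f)  ≡⟨ ∑-++ ys₁ (x ∷ ys₂) f ⟨
  ∑ (ys₁ ++ x ∷ ys₂) f       ∎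
  where
  open ≤-Reasoning
  xs⊆ys₁++ys₂ : ∀ {y} → y ∈ xs → y ∈ ys₁ ++ ys₂
  xs⊆ys₁++ys₂ y∈xs with ∈-++⁻ ys₁ (xs⊆ys (there y∈xs))
  ... | inj₁ y∈ys₁         = ∈-++⁺ˡ y∈ys₁
  ... | inj₂ (here y≡x)    = ⊥-elim (All.lookup x∉xs y∈xs (sym y≡x))
  ... | inj₂ (there y∈ys₂) = ∈-++⁺ʳ ys₁ y∈ys₂

2x[x+t]≤x²+[x+t]² : ∀ x t → 2 * (x * (x + t)) ≤ x * x + (x + t) * (x + t)
2x[x+t]≤x²+[x+t]² x t = subst (2 * (x * (x + t)) ≤_) (gap x t) (m≤m+n _ (t * t))
  where
  gap : ∀ x t → 2 * (x * (x + t)) + t * t ≡ x * x + (x + t) * (x + t)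
  gap = solve 2 (λ x t → con 2 :* (x :* (x :+ t)) :+ t :* t := x :* x :+ (x :+ t) :* (x :+ t)) refl

2xy≤x²+y² : ∀ x y → 2 * (x * y) ≤ x * x + y * y
2xy≤x²+y² x y with ≤-total x y
... | inj₁ x≤y with t , refl ← m≤n⇒∃[o]m+o≡n x≤y = 2x[x+t]≤x²+[x+t]² x t
... | inj₂ y≤x with t , refl ← m≤n⇒∃[o]m+o≡n y≤x =
  subst₂ _≤_ (cong (2 *_) (*-comm y x)) (+-comm (y * y) (x * x)) (2x[x+t]≤x²+[x+t]² y t)

cauchy-schwarz : (xs : List A) (f : A → ℕ) → ∑ xs f * ∑ xs f ≤ length xs * (∑[ x ∈ xs ] f x * f x)
cauchy-schwarz {A = A} xs f = *-cancelˡ-≤ 2 (begin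
  2 * (∑ xs f * ∑ xs f)                                  ≡⟨ cong (2 *_) (∑*∑ xs xs f f) ⟩
  2 * (∑[ x ∈ xs ] ∑[ y ∈ xs ] f x * f y)                ≡⟨ 2*∑∑ ⟨
  ∑[ x ∈ xs ] ∑[ y ∈ xs ] 2 * (f x * f y)                ≤⟨ ∑-mono-≤ {xs = xs} (λ {x} _ →
                                                              ∑-mono-≤ {xs = xs} (λ {y} _ → 2xy≤x²+y² (f x) (f y))) ⟩
  ∑[ x ∈ xs ] ∑[ y ∈ xs ] (sq x + sq y)                  ≡⟨ ∑-cong {xs = xs} (λ {x} _ → ∑-distrib-+ xs (λ _ → sq x) sq) ⟩
  ∑[ x ∈ xs ] ((∑[ y ∈ xs ] sq x) + ∑ xs sq)             ≡⟨ ∑-distrib-+ xs (λ x → ∑[ y ∈ xs ] sq x) (λ _ → ∑ xs sq) ⟩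
  (∑[ x ∈ xs ] ∑[ y ∈ xs ] sq x) + (∑[ x ∈ xs ] ∑ xs sq) ≡⟨ cong₂ _+_ (∑-cong {xs = xs} (λ {x} _ → ∑-const xs (sq x)))
                                                                      (∑-const xs (∑ xs sq)) ⟩
  (∑[ x ∈ xs ] length xs * sq x) + length xs * ∑ xs sq   ≡⟨ cong (_+ length xs * ∑ xs sq) (*-distribˡ-∑ xs (length xs) sq) ⟩
  length xs * ∑ xs sq + length xs * ∑ xs sq              ≡⟨ cong (length xs * ∑ xs sq +_) (+-identityʳ _) ⟨
  2 * (length xs * ∑ xs sq)                              ∎)
  where
  open ≤-Reasoning
  sq : A → ℕ
  sq x = f x * f x
  2*∑∑ : ∑[ x ∈ xs ] ∑[ y ∈ xs ] 2 * (f x * f y) ≡ 2 * (∑[ x ∈ xs ] ∑[ y ∈ xs ] f x * f y)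
  2*∑∑ = trans (∑-cong {xs = xs} (λ {x} _ → *-distribˡ-∑ xs 2 (λ y → f x * f y)))
               (*-distribˡ-∑ xs 2 (λ x → ∑[ y ∈ xs ] f x * f y))

∈-allSubsets : (s : Subset n) → s ∈ allSubsets n
∈-allSubsets {zero}  []            = here refl
∈-allSubsets {suc n} (inside ∷ s)  = ∈-++⁺ˡ (∈-map⁺ (inside ∷_) (∈-allSubsets s))
∈-allSubsets {suc n} (outside ∷ s) =
  ∈-++⁺ʳ (map (inside ∷_) (allSubsets n)) (∈-map⁺ (outside ∷_) (∈-allSubsets s))

∑-allSubsets-suc : (f : Subset (suc n) → ℕ) →
                   ∑ (allSubsets (suc n)) f
                     ≡ (∑[ s ∈ allSubsets n ] f (inside ∷ s)) + (∑[ s ∈ allSubsets n ] f (outside ∷ s))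
∑-allSubsets-suc {n} f =
  trans (∑-++ (map (inside ∷_) (allSubsets n)) _ f)
        (cong₂ _+_ (∑-map (inside ∷_) (allSubsets n) f) (∑-map (outside ∷_) (allSubsets n) f))

#subsets : Subset n → ℕ → ℕ
#subsets {n} d m = ∑[ s ∈ allSubsets n ] 𝟙 (∣ s ∣ ≟ m) * 𝟙 (s ⊆? d)

#supersets : Subset n → ℕ → ℕ
#supersets {n} s l = ∑[ d ∈ allSubsets n ] 𝟙 (∣ d ∣ ≟ l) * 𝟙 (s ⊆? d)

#subsets≡C : (d : Subset n) (m : ℕ) → #subsets d m ≡ ∣ d ∣ C m
#subsets≡C {zero}  []            zero    = refl
#subsets≡C {zero}  []            (suc m) = refl
#subsets≡C {suc n} (inside ∷ d)  zero    =
  trans (∑-allSubsets-suc {n} _) (cong₂ _+_ (∑-≡0 {xs = allSubsets n} (λ _ → refl)) (#subsets≡C d zero))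
#subsets≡C {suc n} (inside ∷ d)  (suc m) =
  trans (∑-allSubsets-suc {n} _)
        (trans (cong₂ _+_ (#subsets≡C d m) (#subsets≡C d (suc m))) (nCk+nC[k+1]≡[n+1]C[k+1] ∣ d ∣ m))
#subsets≡C {suc n} (outside ∷ d) m       =
  trans (∑-allSubsets-suc {n} _)
        (cong₂ _+_ (∑-≡0 {xs = allSubsets n} (λ s → *-zeroʳ (𝟙 (suc ∣ s ∣ ≟ m)))) (#subsets≡C d m))

-- Indexing by the excess k = l ∸ ∣ s ∣ keeps truncated subtraction out of the induction.
#supersets-+≡C : (s : Subset n) (k : ℕ) → #supersets s (∣ s ∣ + k) ≡ (n ∸ ∣ s ∣) C k
#supersets-+≡C {zero}  []            zero    = refl
#supersets-+≡C {zero}  []            (suc k) = refl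
#supersets-+≡C {suc n} (inside ∷ s)  k       =
  trans (∑-allSubsets-suc {n} _)
        (trans (cong₂ _+_ (#supersets-+≡C s k)
                          (∑-≡0 {xs = allSubsets n} (λ d → *-zeroʳ (𝟙 (∣ d ∣ ≟ suc (∣ s ∣ + k))))))
               (+-identityʳ _))
#supersets-+≡C {suc n} (outside ∷ s) zero    =
  trans (∑-allSubsets-suc {n} _)
        (cong₂ _+_ (∑-≡0 {xs = allSubsets n} (λ d → 𝟙*𝟙-disjoint (too-small d) (suc ∣ d ∣ ≟ ∣ s ∣ + 0) (s ⊆? d)))
                   (#supersets-+≡C s zero))
  where
  too-small : (d : Subset n) → suc ∣ d ∣ ≡ ∣ s ∣ + 0 → s ⊆ d → ⊥
  too-small d eq s⊆d = 1+n≰n (≤-trans (≤-reflexive (trans eq (+-identityʳ _))) (p⊆q⇒∣p∣≤∣q∣ s⊆d))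
#supersets-+≡C {suc n} (outside ∷ s) (suc k) = begin
  #supersets (outside ∷ s) (∣ s ∣ + suc k)
    ≡⟨ ∑-allSubsets-suc {n} _ ⟩
  (∑[ d ∈ allSubsets n ] 𝟙 (suc ∣ d ∣ ≟ ∣ s ∣ + suc k) * 𝟙 (s ⊆? d)) + #supersets s (∣ s ∣ + suc k)
    ≡⟨ cong (λ j → (∑[ d ∈ allSubsets n ] 𝟙 (suc ∣ d ∣ ≟ j) * 𝟙 (s ⊆? d)) + #supersets s (∣ s ∣ + suc k))
            (+-suc ∣ s ∣ k) ⟩
  #supersets s (∣ s ∣ + k) + #supersets s (∣ s ∣ + suc k)
    ≡⟨ cong₂ _+_ (#supersets-+≡C s k) (#supersets-+≡C s (suc k)) ⟩
  (n ∸ ∣ s ∣) C k + (n ∸ ∣ s ∣) C suc k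
    ≡⟨ nCk+nC[k+1]≡[n+1]C[k+1] (n ∸ ∣ s ∣) k ⟩
  suc (n ∸ ∣ s ∣) C suc k
    ≡⟨ cong (_C suc k) (+-∸-assoc 1 (∣p∣≤n s)) ⟨
  (suc n ∸ ∣ s ∣) C suc k
    ∎
  where open ≡-Reasoning

#supersets≡C : (s : Subset n) {m l : ℕ} → ∣ s ∣ ≡ m → m ≤ l → #supersets s l ≡ (n ∸ m) C (l ∸ m)
#supersets≡C s refl m≤l = trans (cong (#supersets s) (sym (m+[n∸m]≡n m≤l))) (#supersets-+≡C s _)

#ofSize≡C : (m : ℕ) → ∑[ s ∈ allSubsets n ] 𝟙 (∣ s ∣ ≟ m) ≡ n C m
#ofSize≡C {n} m = begin
  ∑[ s ∈ allSubsets n ] 𝟙 (∣ s ∣ ≟ m)  ≡⟨ ∑-cong {xs = allSubsets n} (λ {s} _ → sym (⊆⊤-redundant s)) ⟩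
  #subsets (⊤ {n}) m                   ≡⟨ #subsets≡C (⊤ {n}) m ⟩
  ∣ ⊤ {n} ∣ C m                        ≡⟨ cong (_C m) (∣⊤∣≡n n) ⟩
  n C m                                ∎
  where
  open ≡-Reasoning
  ⊆⊤-redundant : (s : Subset n) → 𝟙 (∣ s ∣ ≟ m) * 𝟙 (s ⊆? ⊤) ≡ 𝟙 (∣ s ∣ ≟ m)
  ⊆⊤-redundant s = trans (cong (𝟙 (∣ s ∣ ≟ m) *_) (𝟙-yes {P = s ⊆ ⊤} ⊆⊤ (s ⊆? ⊤))) (*-identityʳ _)

∑-𝟙*-const : {P : A → Set p} (P? : ∀ x → Dec (P x)) (xs : List A) {f : A → ℕ} {c : ℕ} →
             (∀ x → P x → f x ≡ c) → ∑[ x ∈ xs ] 𝟙 (P? x) * f x ≡ (∑[ x ∈ xs ] 𝟙 (P? x)) * c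
∑-𝟙*-const P? xs f≡c =
  trans (∑-cong {xs = xs} (λ {x} _ → 𝟙*-cong (P? x) (f≡c x))) (*-distribʳ-∑ xs _ (𝟙 ∘ P?))

-- Both sides count the pairs s ⊆ d of subsets of [n] with ∣ s ∣ ≡ m and ∣ d ∣ ≡ l.
nCm*[n∸m]C[l∸m]≡nCl*lCm : {n m l : ℕ} → m ≤ l → (n C m) * ((n ∸ m) C (l ∸ m)) ≡ (n C l) * (l C m)
nCm*[n∸m]C[l∸m]≡nCl*lCm {n} {m} {l} m≤l = begin
  (n C m) * ((n ∸ m) C (l ∸ m))
    ≡⟨ cong (_* ((n ∸ m) C (l ∸ m))) (#ofSize≡C m) ⟨
  (∑[ s ∈ all ] 𝟙 (∣ s ∣ ≟ m)) * ((n ∸ m) C (l ∸ m))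
    ≡⟨ ∑-𝟙*-const (λ s → ∣ s ∣ ≟ m) all (λ s ∣s∣≡m → #supersets≡C s ∣s∣≡m m≤l) ⟨
  ∑[ s ∈ all ] 𝟙 (∣ s ∣ ≟ m) * #supersets s l
    ≡⟨ ∑-cong {xs = all} (λ {s} _ → *-distribˡ-∑ all (𝟙 (∣ s ∣ ≟ m)) _) ⟨
  ∑[ s ∈ all ] ∑[ d ∈ all ] 𝟙 (∣ s ∣ ≟ m) * (𝟙 (∣ d ∣ ≟ l) * 𝟙 (s ⊆? d))
    ≡⟨ ∑-comm all all _ ⟩
  ∑[ d ∈ all ] ∑[ s ∈ all ] 𝟙 (∣ s ∣ ≟ m) * (𝟙 (∣ d ∣ ≟ l) * 𝟙 (s ⊆? d))
    ≡⟨ ∑-cong {xs = all} (λ {d} _ → ∑-cong {xs = all} (λ {s} _ →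
         *-CS.x∙yz≈y∙xz (𝟙 (∣ s ∣ ≟ m)) (𝟙 (∣ d ∣ ≟ l)) (𝟙 (s ⊆? d)))) ⟩
  ∑[ d ∈ all ] ∑[ s ∈ all ] 𝟙 (∣ d ∣ ≟ l) * (𝟙 (∣ s ∣ ≟ m) * 𝟙 (s ⊆? d))
    ≡⟨ ∑-cong {xs = all} (λ {d} _ → *-distribˡ-∑ all (𝟙 (∣ d ∣ ≟ l)) _) ⟩
  ∑[ d ∈ all ] 𝟙 (∣ d ∣ ≟ l) * #subsets d m
    ≡⟨ ∑-𝟙*-const (λ d → ∣ d ∣ ≟ l) all (λ d ∣d∣≡l → trans (#subsets≡C d m) (cong (_C m) ∣d∣≡l)) ⟩
  (∑[ d ∈ all ] 𝟙 (∣ d ∣ ≟ l)) * (l C m)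
    ≡⟨ cong (_* (l C m)) (#ofSize≡C l) ⟩
  (n C l) * (l C m)
    ∎
  where
  open ≡-Reasoning
  all : List (Subset n)
  all = allSubsets n

∈Ext? : (U : List (Subset n)) (l : ℕ) (d : Subset n) → Dec (∣ d ∣ ≡ l × Any (_⊆ d) U)
∈Ext? U l d = (∣ d ∣ ≟ l) ×-dec any? (_⊆? d) U

∈-Ext⇒∣d∣≡l : {U : List (Subset n)} {l : ℕ} {d : Subset n} → d ∈ Ext U l → ∣ d ∣ ≡ l
∈-Ext⇒∣d∣≡l {n} {U} {l} d∈Ext = proj₁ (proj₂ (∈-filter⁻ (∈Ext? U l) {xs = allSubsets n} d∈Ext))

marks : List (Subset n) → Subset n → ℕ
marks U d = ∑[ t ∈ U ] 𝟙 (t ⊆? d)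

𝟙-∪⊆ : (t t′ d : Subset n) → 𝟙 (t ∪ t′ ⊆? d) ≡ 𝟙 (t ⊆? d) * 𝟙 (t′ ⊆? d)
𝟙-∪⊆ t t′ d = trans (𝟙-⇔ split join (t ∪ t′ ⊆? d) ((t ⊆? d) ×-dec (t′ ⊆? d))) (𝟙-× (t ⊆? d) (t′ ⊆? d))
  where
  split : t ∪ t′ ⊆ d → t ⊆ d × t′ ⊆ d
  split t∪t′⊆d = ⊆-trans (p⊆p∪q t′) t∪t′⊆d , ⊆-trans (q⊆p∪q t t′) t∪t′⊆d
  join : t ⊆ d × t′ ⊆ d → t ∪ t′ ⊆ d
  join (t⊆d , t′⊆d) x∈t∪t′ = [ t⊆d , t′⊆d ]′ (x∈p∪q⁻ t t′ x∈t∪t′)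

length-DoubleMarks : (U V : List (Subset n)) → length (DoubleMarks U V) ≡ ∑[ d ∈ V ] marks U d * marks U d
length-DoubleMarks U V = begin
  length (DoubleMarks U V)
    ≡⟨ length-filter _ (cartesianProduct U (cartesianProduct U V)) ⟩
  ∑ (cartesianProduct U (cartesianProduct U V)) (λ { (t , t′ , d) → 𝟙 (t ∪ t′ ⊆? d) })
    ≡⟨ ∑-cartesianProduct U (cartesianProduct U V) _ ⟩
  ∑[ t ∈ U ] ∑ (cartesianProduct U V) (λ { (t′ , d) → 𝟙 (t ∪ t′ ⊆? d) })
    ≡⟨ ∑-cong {xs = U} (λ {t} _ → ∑-cartesianProduct U V _) ⟩
  ∑[ t ∈ U ] ∑[ t′ ∈ U ] ∑[ d ∈ V ] 𝟙 (t ∪ t′ ⊆? d)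
    ≡⟨ ∑-cong {xs = U} (λ {t} _ → ∑-cong {xs = U} (λ {t′} _ → ∑-cong {xs = V} (λ {d} _ → 𝟙-∪⊆ t t′ d))) ⟩
  ∑[ t ∈ U ] ∑[ t′ ∈ U ] ∑[ d ∈ V ] 𝟙 (t ⊆? d) * 𝟙 (t′ ⊆? d)
    ≡⟨ ∑-cong {xs = U} (λ {t} _ → ∑-comm U V _) ⟩
  ∑[ t ∈ U ] ∑[ d ∈ V ] ∑[ t′ ∈ U ] 𝟙 (t ⊆? d) * 𝟙 (t′ ⊆? d)
    ≡⟨ ∑-comm U V _ ⟩
  ∑[ d ∈ V ] ∑[ t ∈ U ] ∑[ t′ ∈ U ] 𝟙 (t ⊆? d) * 𝟙 (t′ ⊆? d)
    ≡⟨ ∑-cong {xs = V} (λ {d} _ → ∑*∑ U U (λ t → 𝟙 (t ⊆? d)) (λ t → 𝟙 (t ⊆? d))) ⟨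
  ∑[ d ∈ V ] marks U d * marks U d
    ∎
  where open ≡-Reasoning

∑-𝟙⊆-Ext≡#supersets : {U : List (Subset n)} {s : Subset n} (l : ℕ) → s ∈ U →
                      ∑[ d ∈ Ext U l ] 𝟙 (s ⊆? d) ≡ #supersets s l
∑-𝟙⊆-Ext≡#supersets {n} {U} {s} l s∈U =
  trans (∑-filter (∈Ext? U l) (allSubsets n) (λ d → 𝟙 (s ⊆? d)))
        (∑-cong {xs = allSubsets n} (λ {d} _ → superset⇒∈Ext d))
  where
  superset⇒∈Ext : (d : Subset n) → 𝟙 (∈Ext? U l d) * 𝟙 (s ⊆? d) ≡ 𝟙 (∣ d ∣ ≟ l) * 𝟙 (s ⊆? d)
  superset⇒∈Ext d = begin
    𝟙 (∈Ext? U l d) * 𝟙 (s ⊆? d)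
      ≡⟨ cong (_* 𝟙 (s ⊆? d)) (𝟙-× (∣ d ∣ ≟ l) (any? (_⊆? d) U)) ⟩
    𝟙 (∣ d ∣ ≟ l) * 𝟙 (any? (_⊆? d) U) * 𝟙 (s ⊆? d)
      ≡⟨ *-assoc (𝟙 (∣ d ∣ ≟ l)) _ _ ⟩
    𝟙 (∣ d ∣ ≟ l) * (𝟙 (any? (_⊆? d) U) * 𝟙 (s ⊆? d))
      ≡⟨ cong (𝟙 (∣ d ∣ ≟ l) *_) (𝟙*𝟙-implied (lose s∈U) (s ⊆? d) (any? (_⊆? d) U)) ⟩
    𝟙 (∣ d ∣ ≟ l) * 𝟙 (s ⊆? d)
      ∎
    where open ≡-Reasoning

∑-marks-Ext : {U : List (Subset n)} {m l : ℕ} → All (λ s → ∣ s ∣ ≡ m) U → m ≤ l →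
              ∑[ d ∈ Ext U l ] marks U d ≡ length U * ((n ∸ m) C (l ∸ m))
∑-marks-Ext {n} {U} {m} {l} U-size m≤l = begin
  ∑[ d ∈ Ext U l ] marks U d               ≡⟨ ∑-comm (Ext U l) U _ ⟩
  ∑[ s ∈ U ] ∑[ d ∈ Ext U l ] 𝟙 (s ⊆? d)  ≡⟨ ∑-cong {xs = U} (∑-𝟙⊆-Ext≡#supersets l) ⟩
  ∑[ s ∈ U ] #supersets s l                ≡⟨ ∑-cong {xs = U} (λ {s} s∈U →
                                                 #supersets≡C s (All.lookup U-size s∈U) m≤l) ⟩
  ∑[ s ∈ U ] (n ∸ m) C (l ∸ m)             ≡⟨ ∑-const U _ ⟩
  length U * ((n ∸ m) C (l ∸ m))           ∎
  where open ≡-Reasoning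

marks≤C : {U : List (Subset n)} {m : ℕ} → Unique U → All (λ s → ∣ s ∣ ≡ m) U →
          (d : Subset n) → marks U d ≤ ∣ d ∣ C m
marks≤C {n} {U} {m} U-unique U-size d = begin
  marks U d                               ≡⟨ ∑-cong {xs = U} (λ {s} s∈U → sym (size-m s (All.lookup U-size s∈U))) ⟩
  ∑[ s ∈ U ] 𝟙 (∣ s ∣ ≟ m) * 𝟙 (s ⊆? d)  ≤⟨ ∑-mono-⊆ _ U-unique (λ {s} _ → ∈-allSubsets s) ⟩
  #subsets d m                            ≡⟨ #subsets≡C d m ⟩
  ∣ d ∣ C m                               ∎
  where
  open ≤-Reasoning
  size-m : (s : Subset n) → ∣ s ∣ ≡ m → 𝟙 (∣ s ∣ ≟ m) * 𝟙 (s ⊆? d) ≡ 𝟙 (s ⊆? d)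
  size-m s ∣s∣≡m = trans (cong (_* 𝟙 (s ⊆? d)) (𝟙-yes ∣s∣≡m (∣ s ∣ ≟ m))) (*-identityˡ _)

module _ {n m l : ℕ} {U : List (Subset n)} (U-size : All (λ s → ∣ s ∣ ≡ m) U) (m≤l : m ≤ l) where

  private
    V : List (Subset n)
    V = Ext U l
    N : ℕ
    N = length U
    g : ℕ
    g = (n ∸ m) C (l ∸ m)

  DoubleMarks-upper : Unique U → length (DoubleMarks U V) * (n C m) ≤ N * (n C l) * (l C m) ^ 2
  DoubleMarks-upper U-unique = begin
    length (DoubleMarks U V) * (n C m)            ≡⟨ cong (_* (n C m)) (length-DoubleMarks U V) ⟩
    (∑[ d ∈ V ] marks U d * marks U d) * (n C m)  ≤⟨ *-monoˡ-≤ (n C m) (∑-mono-≤ {xs = V} marks²≤lCm*marks) ⟩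
    (∑[ d ∈ V ] (l C m) * marks U d) * (n C m)    ≡⟨ cong (_* (n C m)) (*-distribˡ-∑ V (l C m) (marks U)) ⟩
    (l C m) * ∑ V (marks U) * (n C m)             ≡⟨ cong (λ x → (l C m) * x * (n C m)) (∑-marks-Ext U-size m≤l) ⟩
    (l C m) * (N * g) * (n C m)                   ≡⟨ reorder (l C m) N g (n C m) ⟩
    N * (l C m) * ((n C m) * g)                   ≡⟨ cong (N * (l C m) *_) (nCm*[n∸m]C[l∸m]≡nCl*lCm m≤l) ⟩
    N * (l C m) * ((n C l) * (l C m))             ≡⟨ collect N (l C m) (n C l) ⟩
    N * (n C l) * (l C m) ^ 2                     ∎
    where
    open ≤-Reasoning
    marks²≤lCm*marks : ∀ {d} → d ∈ V → marks U d * marks U d ≤ (l C m) * marks U d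
    marks²≤lCm*marks {d} d∈V =
      *-monoˡ-≤ (marks U d) (≤-trans (marks≤C U-unique U-size d) (≤-reflexive (cong (_C m) (∈-Ext⇒∣d∣≡l d∈V))))
    reorder : ∀ c N g k → c * (N * g) * k ≡ N * c * (k * g)
    reorder = solve 4 (λ c N g k → c :* (N :* g) :* k := N :* c :* (k :* g)) refl
    collect : ∀ N c k → N * c * (k * c) ≡ N * k * c ^ 2
    collect = solve 3 (λ N c k → N :* c :* (k :* c) := N :* k :* c :^ 2) refl

  DoubleMarks-lower : (n C l) ^ 2 * (l C m) ^ 2 * N ^ 2 ≤ length (DoubleMarks U V) * (n C m) ^ 2 * length V
  DoubleMarks-lower = begin
    (n C l) ^ 2 * (l C m) ^ 2 * N ^ 2                  ≡⟨ square-product (n C l) (l C m) N ⟩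
    ((n C l) * (l C m)) ^ 2 * N ^ 2                    ≡⟨ cong (λ x → x ^ 2 * N ^ 2) (nCm*[n∸m]C[l∸m]≡nCl*lCm m≤l) ⟨
    ((n C m) * g) ^ 2 * N ^ 2                          ≡⟨ regroup (n C m) g N ⟩
    (N * g) * (N * g) * (n C m) ^ 2                    ≡⟨ cong (λ x → x * x * (n C m) ^ 2) (∑-marks-Ext U-size m≤l) ⟨
    ∑ V (marks U) * ∑ V (marks U) * (n C m) ^ 2        ≤⟨ *-monoˡ-≤ ((n C m) ^ 2) (cauchy-schwarz V (marks U)) ⟩
    length V * (∑[ d ∈ V ] marks U d * marks U d) * (n C m) ^ 2
                                                       ≡⟨ cong (λ x → length V * x * (n C m) ^ 2) (length-DoubleMarks U V) ⟨
    length V * length (DoubleMarks U V) * (n C m) ^ 2  ≡⟨ *-CS.xy∙z≈yz∙x (length V) _ _ ⟩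
    length (DoubleMarks U V) * (n C m) ^ 2 * length V  ∎
    where
    open ≤-Reasoning
    square-product : ∀ a b c → a ^ 2 * b ^ 2 * c ^ 2 ≡ (a * b) ^ 2 * c ^ 2
    square-product = solve 3 (λ a b c → a :^ 2 :* b :^ 2 :* c :^ 2 := (a :* b) :^ 2 :* c :^ 2) refl
    regroup : ∀ a g N → (a * g) ^ 2 * N ^ 2 ≡ (N * g) * (N * g) * a ^ 2
    regroup = solve 3 (λ a g N → (a :* g) :^ 2 :* N :^ 2 := (N :* g) :* (N :* g) :* a :^ 2) refl

-- U ≢ [] and 1 ≤ l ≤ n only make the sparsities finite; the inequalities hold without them.
lemma2p7 : (n m l : ℕ) (U : List (Subset n)) →
    Unique U → All (λ s → ∣ s ∣ ≡ m) U → U ≢ [] →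
    1 ≤ l → l ≤ n → m < l →
    (length (DoubleMarks U (Ext U l)) * (n C m)
        ≤ length U * (n C l) * (l C m) ^ 2)
    × ((n C l) ^ 2 * (l C m) ^ 2 * length U ^ 2
        ≤ length (DoubleMarks U (Ext U l)) * (n C m) ^ 2 * length (Ext U l))
lemma2p7 n m l U U-unique U-size _ _ _ m<l =
  DoubleMarks-upper U-size (<⇒≤ m<l) U-unique , DoubleMarks-lower U-size (<⇒≤ m<l)
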